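{- For all sufficiently large $n$, $\mathrm{bal}_3(n,P_3)=0$; that is, every $3$-edge-coloring of $K_n$ in which each of the three colors appears on at least one edge contains a path with $3$ edges whose three edges have three distinct colors.
   Context: $P_m$ denotes the path with $m$ edges. $\mathrm{bal}_3(n,G)$ is the minimum integer $m$ such that every $3$-edge-coloring of $K_n$ with more than $m$ edges in each color contains a copy of $G$ in which each color appears on $\lfloor e(G)/3\rfloor$ or $\lceil e(G)/3\rceil$ edges. The paper assumes throughout this part that the host complete graph has sufficiently many vertices. -}

module Defs where

open import Data.Nat using (ℕ)
open import Data.Fin using (Fin)
open import Data.Product using (Σ; ∃; _×_)
open import Relation.Binary.PropositionalEquality using (_≡_; _≢_)

-- A 3-edge-colouring of the complete graph K_n on vertex set Fin n:
-- a symmetric colour function; its values on the diagonal (u , u) are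
-- irrelevant, since only pairs of distinct vertices are edges.
record EdgeColouring3 (n : ℕ) : Set where
  field
    colour : Fin n → Fin n → Fin 3
    symm   : ∀ u v → colour u v ≡ colour v u
open EdgeColouring3 public

ColourUsed : ∀ {n} → EdgeColouring3 n → Fin 3 → Set
ColourUsed {n} c k = Σ (Fin n) λ u → Σ (Fin n) λ v → u ≢ v × colour c u v ≡ k

RainbowP3 : ∀ {n} → EdgeColouring3 n → Set
RainbowP3 {n} c =
  Σ (Fin n) λ v0 → Σ (Fin n) λ v1 → Σ (Fin n) λ v2 → Σ (Fin n) λ v3 →
    (v0 ≢ v1 × v0 ≢ v2 × v0 ≢ v3 × v1 ≢ v2 × v1 ≢ v3 × v2 ≢ v3) ×
    (colour c v0 v1 ≢ colour c v1 v2 ×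
     colour c v0 v1 ≢ colour c v2 v3 ×
     colour c v1 v2 ≢ colour c v2 v3)

-- A vertex v seeing all three colours already forces a rainbow P₃: an edge
-- from a leg to a vertex t outside the star either closes a rainbow path
-- t, leg, v, leg′ or repeats the leg's colour, and in the latter case an edge
-- t₁t₂ between two outside vertices extends to a rainbow path leg, t₁, t₂, leg′
-- through the two legs of the other colours. Otherwise pick a vertex v seeing
-- two colours a, b (it exists as soon as two colours are used) and an edge uw
-- of the third colour g. If vu has colour g, v sees all three colours; if not,
-- the leg p of v in the colour different from those of vu and uw makes
-- p, v, u, w a rainbow path, unless p = w, where v, p, u is a rainbow triangle.
-- A rainbow triangle together with any fourth vertex yields a rainbow path or
-- a rainbow star.
module Submission where

open import Defs
open import Data.Nat using (ℕ; _≥_; _<_; _≤_; s≤s; z≤n)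
open import Data.Nat.Properties using (<⇒≤; <⇒≱)
open import Data.Fin using (Fin; zero; suc)
open import Data.Fin.Properties
  using (_≟_; any?; ¬∀⟶∃¬; injective⇒≤; punchOut-injective)
open import Data.Vec.Functional using ([]; _∷_)
open import Data.Product using (∃; ∃₂; _×_; _,_; proj₁; proj₂; map₂)
open import Data.Sum using (_⊎_; inj₁; inj₂)
open import Function using (_∘_)
open import Relation.Nullary using (¬_; Dec; yes; no)
open import Relation.Binary.PropositionalEquality
  using (_≡_; _≢_; refl; sym; trans; cong; subst; subst₂; ≢-sym)

∃-∉-image : ∀ {k n} (f : Fin k → Fin n) → k < n → ∃ λ t → ∀ i → f i ≢ t
∃-∉-image {k} {n} f k<n =
  map₂ (λ t∉f i fi≡t → t∉f (i , fi≡t))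
       (¬∀⟶∃¬ n (λ t → ∃ λ i → f i ≡ t) (λ t → any? (λ i → f i ≟ t)) ¬onto)
  where
  ¬onto : ¬ (∀ t → ∃ λ i → f i ≡ t)
  ¬onto onto = <⇒≱ k<n (injective⇒≤ preimage-injective)
    where
    preimage-injective : ∀ {s t} → proj₁ (onto s) ≡ proj₁ (onto t) → s ≡ t
    preimage-injective {s} {t} eq =
      trans (sym (proj₂ (onto s))) (trans (cong f eq) (proj₂ (onto t)))

third-colour : (a b : Fin 3) → ∃ λ g → a ≢ g × b ≢ g
third-colour a b with g , ∉ab ← ∃-∉-image (a ∷ b ∷ []) (s≤s (s≤s (s≤s z≤n)))
  = g , ∉ab zero , ∉ab (suc zero)

other-two : (k : Fin 3) → ∃₂ λ q r → k ≢ q × k ≢ r × q ≢ r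
other-two zero             = suc zero , suc (suc zero) , (λ ()) , (λ ()) , (λ ())
other-two (suc zero)       = zero , suc (suc zero) , (λ ()) , (λ ()) , (λ ())
other-two (suc (suc zero)) = zero , suc zero , (λ ()) , (λ ()) , (λ ())

-- Punching out a and then b leaves g and k in Fin 1.
third-unique : ∀ {a b g k : Fin 3} →
  a ≢ b → a ≢ g → a ≢ k → b ≢ g → b ≢ k → g ≡ k
third-unique a≢b a≢g a≢k b≢g b≢k =
  punchOut-injective a≢g a≢k
    (punchOut-injective (b≢g ∘ punchOut-injective a≢b a≢g)
                        (b≢k ∘ punchOut-injective a≢b a≢k)
                        (Fin1-unique _ _))
  where
  Fin1-unique : (i j : Fin 1) → i ≡ j
  Fin1-unique zero zero = refl

module _ {n : ℕ} (c : EdgeColouring3 n) where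

  private
    col : Fin n → Fin n → Fin 3
    col = colour c

  Sees : Fin n → Fin 3 → Set
  Sees v k = ∃ λ p → v ≢ p × col v p ≡ k

  col-≢⇒≢ : ∀ {v p q α β} → col v p ≡ α → col v q ≡ β → α ≢ β → p ≢ q
  col-≢⇒≢ {v} vp≡α vq≡β α≢β p≡q =
    subst₂ _≢_ (sym vp≡α) (sym vq≡β) α≢β (cong (col v) p≡q)

  rainbow-path : ∀ {v₀ v₁ v₂ v₃ α β γ} →
    v₀ ≢ v₁ → v₁ ≢ v₂ → v₂ ≢ v₃ → v₀ ≢ v₃ →
    col v₀ v₁ ≡ α → col v₁ v₂ ≡ β → col v₂ v₃ ≡ γ →
    α ≢ β → α ≢ γ → β ≢ γ → RainbowP3 c
  rainbow-path {v₀} {v₁} {v₂} {v₃} v₀≢v₁ v₁≢v₂ v₂≢v₃ v₀≢v₃ e₀₁ e₁₂ e₂₃ α≢β α≢γ β≢γ =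
    v₀ , v₁ , v₂ , v₃ ,
    (v₀≢v₁ , v₀≢v₂ , v₀≢v₃ , v₁≢v₂ , v₁≢v₃ , v₂≢v₃) ,
    (≢-by e₀₁ e₁₂ α≢β , ≢-by e₀₁ e₂₃ α≢γ , ≢-by e₁₂ e₂₃ β≢γ)
    where
    ≢-by : ∀ {x y α β : Fin 3} → x ≡ α → y ≡ β → α ≢ β → x ≢ y
    ≢-by x≡α y≡β = subst₂ _≢_ (sym x≡α) (sym y≡β)
    v₀≢v₂ : v₀ ≢ v₂
    v₀≢v₂ = col-≢⇒≢ (trans (symm c v₁ v₀) e₀₁) e₁₂ α≢β
    v₁≢v₃ : v₁ ≢ v₃
    v₁≢v₃ = col-≢⇒≢ (trans (symm c v₂ v₁) e₁₂) e₂₃ β≢γ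

  sees-all : ∀ {v a b g} → a ≢ b → a ≢ g → b ≢ g →
    Sees v a → Sees v b → Sees v g → ∀ k → Sees v k
  sees-all {v} {a} {b} a≢b a≢g b≢g sa sb sg k with k ≟ a | k ≟ b
  ... | yes refl | _        = sa
  ... | no _     | yes refl = sb
  ... | no k≢a   | no k≢b   =
    subst (Sees v) (third-unique a≢b a≢g (≢-sym k≢a) b≢g (≢-sym k≢b)) sg

  module _ (6≤n : 6 ≤ n) where

    module RainbowStar {v} (sees : ∀ k → Sees v k) where

      leg : Fin 3 → Fin n
      leg k = proj₁ (sees k)

      v≢leg : ∀ k → v ≢ leg k
      v≢leg k = proj₁ (proj₂ (sees k))

      leg-colour : ∀ k → col v (leg k) ≡ k
      leg-colour k = proj₂ (proj₂ (sees k))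

      leg-edge-colour : ∀ t → (∀ i → (v ∷ leg) i ≢ t) → ∀ k →
        RainbowP3 c ⊎ col (leg k) t ≡ k
      leg-edge-colour t t-new k with col (leg k) t ≟ k
      ... | yes kt≡k = inj₂ kt≡k
      ... | no kt≢k with r , k≢r , kt≢r ← third-colour k (col (leg k) t) =
        inj₁ (rainbow-path (≢-sym (t-new (suc k))) (≢-sym (v≢leg k)) (v≢leg r)
                (≢-sym (t-new (suc r)))
                (symm c t (leg k)) (trans (symm c (leg k) v) (leg-colour k)) (leg-colour r)
                kt≢k kt≢r k≢r)

      rainbow : RainbowP3 c
      rainbow
        with t₁ , t₁-new ← ∃-∉-image (v ∷ leg) (<⇒≤ 6≤n)
        with t₂ , t₂-new ← ∃-∉-image (t₁ ∷ v ∷ leg) 6≤n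
        with q , r , k≢q , k≢r , q≢r ← other-two (col t₁ t₂)
        with leg-edge-colour t₁ t₁-new q | leg-edge-colour t₂ (t₂-new ∘ suc) r
      ... | inj₁ p₃    | _          = p₃
      ... | inj₂ _     | inj₁ p₃    = p₃
      ... | inj₂ qt₁≡q | inj₂ rt₂≡r =
        rainbow-path (t₁-new (suc q)) (t₂-new zero) (≢-sym (t₂-new (suc (suc r))))
          (col-≢⇒≢ (leg-colour q) (leg-colour r) q≢r)
          qt₁≡q refl (trans (symm c t₂ (leg r)) rt₂≡r)
          (≢-sym k≢q) q≢r k≢r

    rainbow-star⇒P3 : ∀ {v} → (∀ k → Sees v k) → RainbowP3 c
    rainbow-star⇒P3 = RainbowStar.rainbow

    rainbow-triangle⇒P3 : ∀ {v x y a b g} → v ≢ x → v ≢ y →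
      col v x ≡ a → col v y ≡ b → col x y ≡ g → a ≢ b → a ≢ g → b ≢ g → RainbowP3 c
    rainbow-triangle⇒P3 {v} {x} {y} {a} {b} v≢x v≢y vx≡a vy≡b xy≡g a≢b a≢g b≢g
      with z , z-new ← ∃-∉-image (v ∷ x ∷ y ∷ []) (<⇒≤ (<⇒≤ 6≤n))
      with col v z ≟ a | col v z ≟ b
    ... | yes vz≡a | _ =
      rainbow-path (≢-sym (z-new zero)) v≢y (col-≢⇒≢ vy≡b vx≡a (≢-sym a≢b))
        (≢-sym (z-new (suc zero)))
        (trans (symm c z v) vz≡a) vy≡b (trans (symm c y x) xy≡g) a≢b a≢g b≢g
    ... | no _ | yes vz≡b =
      rainbow-path (≢-sym (z-new zero)) v≢x (col-≢⇒≢ vx≡a vy≡b a≢b)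
        (≢-sym (z-new (suc (suc zero))))
        (trans (symm c z v) vz≡b) vx≡a xy≡g (≢-sym a≢b) b≢g a≢g
    ... | no vz≢a | no vz≢b =
      rainbow-star⇒P3
        (sees-all a≢b a≢g b≢g (x , v≢x , vx≡a) (y , v≢y , vy≡b)
          (z , z-new zero ,
           sym (third-unique a≢b a≢g (≢-sym vz≢a) b≢g (≢-sym vz≢b))))

    cherry+edge⇒P3 : ∀ {v a b u w g} → a ≢ b → a ≢ g → b ≢ g →
      Sees v a → Sees v b → u ≢ w → col u w ≡ g → RainbowP3 c
    cherry+edge⇒P3 {v} {a} {_} {u} {w} {g} a≢b a≢g b≢g sa sb u≢w uw≡g =
      cases (u ≟ v) (col v u ≟ g)
      where
      star : Sees v g → RainbowP3 c
      star sg = rainbow-star⇒P3 (sees-all a≢b a≢g b≢g sa sb sg)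
      through : ∀ {r} → v ≢ u → col v u ≢ g → Sees v r → r ≢ col v u → r ≢ g →
        RainbowP3 c
      through v≢u vu≢g (p , v≢p , vp≡r) r≢vu r≢g with p ≟ w
      ... | yes refl =
        rainbow-triangle⇒P3 v≢p v≢u vp≡r refl (trans (symm c p u) uw≡g) r≢vu r≢g vu≢g
      ... | no p≢w =
        rainbow-path (≢-sym v≢p) v≢u u≢w p≢w (trans (symm c p v) vp≡r) refl uw≡g
          r≢vu r≢g vu≢g
      cases : Dec (u ≡ v) → Dec (col v u ≡ g) → RainbowP3 c
      cases (yes u≡v) _          = star (subst (λ x → Sees x g) u≡v (w , u≢w , uw≡g))
      cases (no u≢v)  (yes vu≡g) = star (u , ≢-sym u≢v , vu≡g)
      cases (no u≢v)  (no vu≢g) with a ≟ col v u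
      ... | yes a≡vu = through (≢-sym u≢v) vu≢g sb (λ b≡vu → a≢b (trans a≡vu (sym b≡vu)))
                         b≢g
      ... | no a≢vu  = through (≢-sym u≢v) vu≢g sa a≢vu a≢g

  two-colours⇒cherry : ∀ {a b} → a ≢ b → ColourUsed c a → ColourUsed c b →
    ∃ λ v → ∃₂ λ a′ b′ → a′ ≢ b′ × Sees v a′ × Sees v b′
  two-colours⇒cherry {a} {b} a≢b (p , sa) (r , s , r≢s , rs≡b) with p ≟ r
  ... | yes refl = p , a , b , a≢b , sa , (s , r≢s , rs≡b)
  ... | no p≢r with col p r ≟ a
  ...   | yes pr≡a =
    r , a , b , a≢b , (p , ≢-sym p≢r , trans (symm c r p) pr≡a) , (s , r≢s , rs≡b)
  ...   | no pr≢a = p , a , col p r , ≢-sym pr≢a , sa , (r , p≢r , refl)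

  all-colours⇒P3 : 6 ≤ n → (∀ k → ColourUsed c k) → RainbowP3 c
  all-colours⇒P3 6≤n used
    with _ , a , b , a≢b , sa , sb ← two-colours⇒cherry (λ ()) (used zero) (used (suc zero))
    with g , a≢g , b≢g ← third-colour a b
    with u , w , u≢w , uw≡g ← used g
    = cherry+edge⇒P3 6≤n a≢b a≢g b≢g sa sb u≢w uw≡g

proposition3p2 : ∃ λ N → ∀ (n : ℕ) → n ≥ N →
    (c : EdgeColouring3 n) → (∀ (k : Fin 3) → ColourUsed c k) → RainbowP3 c
proposition3p2 = 6 , λ n 6≤n c → all-colours⇒P3 c 6≤n
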